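{- Over the system $\text{E-HA}^{\omega*}_{\mathrm{st}}$, the idealisation schema $\mathsf{I}$ and the sequence overspill schema $\mathsf{OS}^*$ are equivalent: $\text{E-HA}^{\omega*}_{\mathrm{st}} \vdash \mathsf{I} \leftrightarrow \mathsf{OS}^*$, where $\mathsf{I}$: $\forall^{\mathrm{st}} s:\sigma^* \, \exists y:\tau \, \forall x \in s \, \varphi(x,y) \to \exists y:\tau \, \forall^{\mathrm{st}} x:\sigma \, \varphi(x,y)$, $\mathsf{OS}^*$: $\forall^{\mathrm{st}} s:\sigma^* \, \varphi(s) \to \exists s:\sigma^* \,(\mathrm{hyper}_\sigma(s) \land \varphi(s))$, for all types $\sigma,\tau$ and all internal formulae $\varphi$ (possibly with further free variables).
   Context: $\text{E-HA}^{\omega*}$ is extensional Heyting arithmetic in all finite types (including the extensionality axiom $f =_{\sigma\to\tau} g \leftrightarrow \forall x\, fx = gx$) over the types generated by: $0$ is a type; if $\sigma,\tau$ are types, so are $\sigma\to\tau$ and $\sigma^*$ (finite sequences of elements of type $\sigma$). For all types there are constants $\langle\rangle_\sigma:\sigma^*$ (empty sequence), $C:\sigma\to\sigma^*\to\sigma^*$ (prepending), and a list recursor $\mathrm{L}_{\sigma,\tau}$ with axioms $\mathrm{L}xy\langle\rangle = x$, $\mathrm{L}xy(Czs) = y(\mathrm{L}xys)\langle z\rangle$ (where $\langle z\rangle = Cz\langle\rangle$), together with the axiom $\forall s:\sigma^*(s=\langle\rangle \lor \exists x\,\exists s'\,(s = Cxs'))$. Defined operations: length $|s|$, projection $s_i$,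 concatenation $s\cdot t$. Write $a \in s :\equiv \exists i<|s|\,(a = s_i)$ and $s'\subseteq s :\equiv \forall x\,(x\in s' \to x \in s)$. The system $\text{E-HA}^{\omega*}_{\mathrm{st}}$ extends the language with a unary predicate $\mathrm{st}_\sigma$ for each type and external quantifiers $\forall^{\mathrm{st}}x\,\Phi :\leftrightarrow \forall x(\mathrm{st}(x)\to\Phi)$, $\exists^{\mathrm{st}}x\,\Phi :\leftrightarrow \exists x(\mathrm{st}(x)\land\Phi)$. Formulae of the language of $\text{E-HA}^{\omega*}$ (not containing $\mathrm{st}$) are called internal and are written with lowercase Greek letters; arbitrary formulae are written with uppercase Greek letters. Its axioms are those of $\text{E-HA}^{\omega*}$ (with the induction schema only for internal formulae), plus: $\mathrm{st}_\sigma(x)\land x=y\to\mathrm{st}_\sigma(y)$; $\mathrm{st}_\sigma(a)$ for every closed term $a$; $\mathrm{st}(f)\land\mathrm{st}(x)\to\mathrm{st}(fx)$; and external induction $(\Phi(0)\land\forall^{\mathrm{st}}x:0\,(\Phi(x)\to\Phi(\mathrm{S}x)))\to\forall^{\mathrm{st}}x:0\,\Phi(x)$ for all formulae $\Phi$. For $s:\sigma^*$, $\mathrm{hyper}_\sigma(s) :\equiv \forall^{\mathrm{st}}x:\sigma\,(x\in s)$. -}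

module Defs where

open import Data.List using (List; []; _∷_; map)
open import Data.List.Membership.Propositional using (_∈_)

infixr 30 _⇒_
infix  35 _*
infixl 40 _·_
infix  20 _≐_
infixl 35 _+'_
infix  20 _<'_ _∈'_
infixr 15 _∧'_
infixr 14 _∨'_
infixr 13 _⊃_ _⇔'_

data Ty : Set where
  ι    : Ty
  _⇒_  : Ty → Ty → Ty
  _*   : Ty → Ty

Ctx : Set
Ctx = List Ty

data Var : Ctx → Ty → Set where
  here  : ∀ {Γ σ} → Var (σ ∷ Γ) σ
  there : ∀ {Γ σ τ} → Var Γ σ → Var (τ ∷ Γ) σ

-- Constants of E-HA^{ω*}: 0, S, combinators Π (K), Σ (S), Gödel
-- recursor R, and for sequences ⟨⟩, C and the list recursor L.

data Const : Ty → Set where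
  zeroC : Const ι
  sucC  : Const (ι ⇒ ι)
  K     : ∀ {σ τ} → Const (σ ⇒ τ ⇒ σ)
  S     : ∀ {ρ σ τ} → Const ((ρ ⇒ σ ⇒ τ) ⇒ (ρ ⇒ σ) ⇒ ρ ⇒ τ)
  R     : ∀ {σ} → Const (σ ⇒ (σ ⇒ ι ⇒ σ) ⇒ ι ⇒ σ)
  nil   : ∀ {σ} → Const (σ *)
  C     : ∀ {σ} → Const (σ ⇒ σ * ⇒ σ *)
  L     : ∀ {σ τ} → Const (τ ⇒ (τ ⇒ σ ⇒ τ) ⇒ σ * ⇒ τ)

data Tm (Γ : Ctx) : Ty → Set where
  var : ∀ {σ} → Var Γ σ → Tm Γ σ
  con : ∀ {σ} → Const σ → Tm Γ σ
  _·_ : ∀ {σ τ} → Tm Γ (σ ⇒ τ) → Tm Γ σ → Tm Γ τ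

data Fm (Γ : Ctx) : Set where
  _≐_  : ∀ {σ} → Tm Γ σ → Tm Γ σ → Fm Γ
  st   : ∀ {σ} → Tm Γ σ → Fm Γ
  ⊥'   : Fm Γ
  _∧'_ : Fm Γ → Fm Γ → Fm Γ
  _∨'_ : Fm Γ → Fm Γ → Fm Γ
  _⊃_  : Fm Γ → Fm Γ → Fm Γ
  All  : (σ : Ty) → Fm (σ ∷ Γ) → Fm Γ
  Ex   : (σ : Ty) → Fm (σ ∷ Γ) → Fm Γ

data Internal {Γ : Ctx} : Fm Γ → Set where
  i≐ : ∀ {σ} {s t : Tm Γ σ} → Internal (s ≐ t)
  i⊥ : Internal ⊥'
  i∧ : ∀ {φ ψ} → Internal φ → Internal ψ → Internal (φ ∧' ψ)
  i∨ : ∀ {φ ψ} → Internal φ → Internal ψ → Internal (φ ∨' ψ)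
  i⊃ : ∀ {φ ψ} → Internal φ → Internal ψ → Internal (φ ⊃ ψ)
  iA : ∀ {σ φ} → Internal φ → Internal (All σ φ)
  iE : ∀ {σ φ} → Internal φ → Internal (Ex σ φ)

_⇔'_ : ∀ {Γ} → Fm Γ → Fm Γ → Fm Γ
φ ⇔' ψ = (φ ⊃ ψ) ∧' (ψ ⊃ φ)

¬' : ∀ {Γ} → Fm Γ → Fm Γ
¬' φ = φ ⊃ ⊥'

Ren : Ctx → Ctx → Set
Ren Γ Δ = ∀ {σ} → Var Γ σ → Var Δ σ

liftR : ∀ {Γ Δ τ} → Ren Γ Δ → Ren (τ ∷ Γ) (τ ∷ Δ)
liftR ρ here      = here
liftR ρ (there x) = there (ρ x)

renT : ∀ {Γ Δ σ} → Ren Γ Δ → Tm Γ σ → Tm Δ σ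
renT ρ (var x) = var (ρ x)
renT ρ (con c) = con c
renT ρ (t · u) = renT ρ t · renT ρ u

renF : ∀ {Γ Δ} → Ren Γ Δ → Fm Γ → Fm Δ
renF ρ (s ≐ t)  = renT ρ s ≐ renT ρ t
renF ρ (st t)   = st (renT ρ t)
renF ρ ⊥'       = ⊥'
renF ρ (φ ∧' ψ) = renF ρ φ ∧' renF ρ ψ
renF ρ (φ ∨' ψ) = renF ρ φ ∨' renF ρ ψ
renF ρ (φ ⊃ ψ)  = renF ρ φ ⊃ renF ρ ψ
renF ρ (All σ φ) = All σ (renF (liftR ρ) φ)
renF ρ (Ex σ φ)  = Ex σ (renF (liftR ρ) φ)

wkT : ∀ {Γ σ τ} → Tm Γ σ → Tm (τ ∷ Γ) σ
wkT = renT there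

wkF : ∀ {Γ τ} → Fm Γ → Fm (τ ∷ Γ)
wkF = renF there

Sub : Ctx → Ctx → Set
Sub Γ Δ = ∀ {σ} → Var Γ σ → Tm Δ σ

liftS : ∀ {Γ Δ τ} → Sub Γ Δ → Sub (τ ∷ Γ) (τ ∷ Δ)
liftS θ here      = var here
liftS θ (there x) = wkT (θ x)

subT : ∀ {Γ Δ σ} → Sub Γ Δ → Tm Γ σ → Tm Δ σ
subT θ (var x) = θ x
subT θ (con c) = con c
subT θ (t · u) = subT θ t · subT θ u

subF : ∀ {Γ Δ} → Sub Γ Δ → Fm Γ → Fm Δ
subF θ (s ≐ t)  = subT θ s ≐ subT θ t
subF θ (st t)   = st (subT θ t)
subF θ ⊥'       = ⊥'
subF θ (φ ∧' ψ) = subF θ φ ∧' subF θ ψ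
subF θ (φ ∨' ψ) = subF θ φ ∨' subF θ ψ
subF θ (φ ⊃ ψ)  = subF θ φ ⊃ subF θ ψ
subF θ (All σ φ) = All σ (subF (liftS θ) φ)
subF θ (Ex σ φ)  = Ex σ (subF (liftS θ) φ)

single : ∀ {Γ σ} → Tm Γ σ → Sub (σ ∷ Γ) Γ
single t here      = t
single t (there x) = var x

_[_] : ∀ {Γ σ} → Fm (σ ∷ Γ) → Tm Γ σ → Fm Γ
φ [ t ] = subF (single t) φ

-- replace variable 0 by a term over the same context (e.g. φ(Sx) from φ(x))
at0 : ∀ {Γ σ} → Tm (σ ∷ Γ) σ → Sub (σ ∷ Γ) (σ ∷ Γ)
at0 t here      = t
at0 t (there x) = var (there x)

closed : ∀ {Γ σ} → Tm [] σ → Tm Γ σ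
closed = renT (λ ())

-- λ-abstraction by bracket abstraction (meta-level notation only)

lam : ∀ {Γ σ τ} → Tm (σ ∷ Γ) τ → Tm Γ (σ ⇒ τ)
lam {σ = σ} (var here) = con (S {σ} {σ ⇒ σ} {σ}) · con K · con (K {σ} {σ})
lam (var (there x)) = con K · var x
lam (con c)         = con K · con c
lam (t · u)         = con S · lam t · lam u

v0 : ∀ {Γ σ} → Tm (σ ∷ Γ) σ
v0 = var here

v1 : ∀ {Γ σ τ} → Tm (τ ∷ σ ∷ Γ) σ
v1 = var (there here)

v2 : ∀ {Γ σ τ ρ} → Tm (ρ ∷ τ ∷ σ ∷ Γ) σ
v2 = var (there (there here))

Sc : ∀ {Γ} → Tm Γ ι → Tm Γ ι
Sc t = con sucC · t

dflt : ∀ {Γ} (σ : Ty) → Tm Γ σ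
dflt ι       = con zeroC
dflt (σ ⇒ τ) = con K · dflt τ
dflt (σ *)   = con nil

_+'_ : ∀ {Γ} → Tm Γ ι → Tm Γ ι → Tm Γ ι
m +' n = con R · m · lam (lam (Sc v1)) · n

_<'_ : ∀ {Γ} → Tm Γ ι → Tm Γ ι → Fm Γ
i <' n = Ex ι (wkT i +' Sc v0 ≐ wkT n)

len : ∀ {Γ σ} → Tm Γ (σ *) → Tm Γ ι
len {σ = σ} s = con (L {σ} {ι}) · con zeroC · lam (lam (Sc v1)) · s

-- s_i : (C z s)_0 = z, (C z s)_{j+1} = s_j, out of range: default
proj : ∀ {Γ σ} → Tm Γ (σ *) → Tm Γ ι → Tm Γ σ
proj {σ = σ} s i =
  con (L {σ} {ι ⇒ σ})
    · lam (dflt σ)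
    · lam (lam (lam (con R · v1 · lam (lam (var (there (there (there (there here)))) · v0)) · v0)))
    · s · i

_∈'_ : ∀ {Γ σ} → Tm Γ σ → Tm Γ (σ *) → Fm Γ
a ∈' s = Ex ι ((v0 <' len (wkT s)) ∧' (wkT a ≐ proj (wkT s) v0))

hyper : ∀ {Γ} (σ : Ty) → Tm Γ (σ *) → Fm Γ
hyper σ s = All σ (st v0 ⊃ (v0 ∈' wkT s))

data Base {Γ : Ctx} : Fm Γ → Set where
  eq-refl  : ∀ {σ} (t : Tm Γ σ) → Base (t ≐ t)
  eq-subst : ∀ {σ} (φ : Fm (σ ∷ Γ)) → Internal φ → (s t : Tm Γ σ) →
             Base ((s ≐ t) ⊃ φ [ s ] ⊃ φ [ t ])
  ext      : ∀ {σ τ} (f g : Tm Γ (σ ⇒ τ)) →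
             Base ((f ≐ g) ⇔' All σ (wkT f · v0 ≐ wkT g · v0))
  suc-ne0  : (t : Tm Γ ι) → Base (¬' (Sc t ≐ con zeroC))
  suc-inj  : (s t : Tm Γ ι) → Base ((Sc s ≐ Sc t) ⊃ (s ≐ t))
  ax-K     : ∀ {σ τ} (x : Tm Γ σ) (y : Tm Γ τ) → Base (con K · x · y ≐ x)
  ax-S     : ∀ {ρ σ τ} (x : Tm Γ (ρ ⇒ σ ⇒ τ)) (y : Tm Γ (ρ ⇒ σ)) (z : Tm Γ ρ) →
             Base (con S · x · y · z ≐ x · z · (y · z))
  ax-R0    : ∀ {σ} (y : Tm Γ σ) (z : Tm Γ (σ ⇒ ι ⇒ σ)) →
             Base (con R · y · z · con zeroC ≐ y)
  ax-RS    : ∀ {σ} (y : Tm Γ σ) (z : Tm Γ (σ ⇒ ι ⇒ σ)) (n : Tm Γ ι) →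
             Base (con R · y · z · Sc n ≐ z · (con R · y · z · n) · n)
  ax-L0    : ∀ {σ τ} (x : Tm Γ τ) (y : Tm Γ (τ ⇒ σ ⇒ τ)) →
             Base (con (L {σ} {τ}) · x · y · con nil ≐ x)
  ax-LC    : ∀ {σ τ} (x : Tm Γ τ) (y : Tm Γ (τ ⇒ σ ⇒ τ)) (z : Tm Γ σ) (s : Tm Γ (σ *)) →
             Base (con L · x · y · (con C · z · s) ≐ y · (con L · x · y · s) · z)
  ax-seq   : ∀ {σ} → Base (All (σ *) ((v0 ≐ con nil) ∨'
                              Ex σ (Ex (σ *) (v2 ≐ con C · v1 · v0))))
  ind      : (φ : Fm (ι ∷ Γ)) → Internal φ →
             Base (φ [ con zeroC ] ⊃ All ι (φ ⊃ subF (at0 (Sc v0)) φ) ⊃ All ι φ)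
  st-eq    : ∀ {σ} (x y : Tm Γ σ) → Base ((st x ∧' (x ≐ y)) ⊃ st y)
  st-closed : ∀ {σ} (a : Tm [] σ) → Base (st (closed a))
  st-app   : ∀ {σ τ} (f : Tm Γ (σ ⇒ τ)) (x : Tm Γ σ) → Base ((st f ∧' st x) ⊃ st (f · x))
  ext-ind  : (Φ : Fm (ι ∷ Γ)) →
             Base (Φ [ con zeroC ] ⊃ All ι (st v0 ⊃ Φ ⊃ subF (at0 (Sc v0)) Φ)
                    ⊃ All ι (st v0 ⊃ Φ))

-- I : ∀^st s:σ* ∃y:τ ∀x∈s φ(x,y) → ∃y:τ ∀^st x:σ φ(x,y)
-- φ(x,y) : x = variable 0 (type σ), y = variable 1 (type τ)
I-inst : ∀ {Γ} (σ τ : Ty) → Fm (σ ∷ τ ∷ Γ) → Fm Γ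
I-inst σ τ φ =
  All (σ *) (st v0 ⊃ Ex τ (All σ ((v0 ∈' v2) ⊃ renF (liftR (liftR there)) φ)))
  ⊃ Ex τ (All σ (st v0 ⊃ φ))

OS-inst : ∀ {Γ} (σ : Ty) → Fm (σ * ∷ Γ) → Fm Γ
OS-inst σ φ = All (σ *) (st v0 ⊃ φ) ⊃ Ex (σ *) (hyper σ v0 ∧' φ)

Theory : Set₁
Theory = ∀ {Γ} → Fm Γ → Set

data ISchema {Γ : Ctx} : Fm Γ → Set where
  inst : ∀ σ τ (φ : Fm (σ ∷ τ ∷ Γ)) → Internal φ → ISchema (I-inst σ τ φ)

data OSSchema {Γ : Ctx} : Fm Γ → Set where
  inst : ∀ σ (φ : Fm (σ * ∷ Γ)) → Internal φ → OSSchema (OS-inst σ φ)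

data _+Ax_ (T U : Theory) {Γ : Ctx} (φ : Fm Γ) : Set where
  base  : T φ → (T +Ax U) φ
  extra : U φ → (T +Ax U) φ

data Der (T : Theory) : (Γ : Ctx) → List (Fm Γ) → Fm Γ → Set where
  hyp  : ∀ {Γ Δ φ} → φ ∈ Δ → Der T Γ Δ φ
  ax   : ∀ {Γ Δ φ} → T φ → Der T Γ Δ φ
  ⊥E   : ∀ {Γ Δ φ} → Der T Γ Δ ⊥' → Der T Γ Δ φ
  ∧I   : ∀ {Γ Δ φ ψ} → Der T Γ Δ φ → Der T Γ Δ ψ → Der T Γ Δ (φ ∧' ψ)
  ∧E₁  : ∀ {Γ Δ φ ψ} → Der T Γ Δ (φ ∧' ψ) → Der T Γ Δ φ
  ∧E₂  : ∀ {Γ Δ φ ψ} → Der T Γ Δ (φ ∧' ψ) → Der T Γ Δ ψ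
  ∨I₁  : ∀ {Γ Δ φ ψ} → Der T Γ Δ φ → Der T Γ Δ (φ ∨' ψ)
  ∨I₂  : ∀ {Γ Δ φ ψ} → Der T Γ Δ ψ → Der T Γ Δ (φ ∨' ψ)
  ∨E   : ∀ {Γ Δ φ ψ χ} → Der T Γ Δ (φ ∨' ψ) →
         Der T Γ (φ ∷ Δ) χ → Der T Γ (ψ ∷ Δ) χ → Der T Γ Δ χ
  ⊃I   : ∀ {Γ Δ φ ψ} → Der T Γ (φ ∷ Δ) ψ → Der T Γ Δ (φ ⊃ ψ)
  ⊃E   : ∀ {Γ Δ φ ψ} → Der T Γ Δ (φ ⊃ ψ) → Der T Γ Δ φ → Der T Γ Δ ψ
  ∀I   : ∀ {Γ Δ σ φ} → Der T (σ ∷ Γ) (map wkF Δ) φ → Der T Γ Δ (All σ φ)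
  ∀E   : ∀ {Γ Δ σ φ} → Der T Γ Δ (All σ φ) → (t : Tm Γ σ) → Der T Γ Δ (φ [ t ])
  ∃I   : ∀ {Γ Δ σ φ} (t : Tm Γ σ) → Der T Γ Δ (φ [ t ]) → Der T Γ Δ (Ex σ φ)
  ∃E   : ∀ {Γ Δ σ φ ψ} → Der T Γ Δ (Ex σ φ) →
         Der T (σ ∷ Γ) (φ ∷ map wkF Δ) (wkF ψ) → Der T Γ Δ ψ

_⊢_ : Theory → ∀ {Γ} → Fm Γ → Set
T ⊢ φ = Der T _ [] φ

module Submission where

-- Both directions are short natural-deduction
-- derivations, each applying one schema instance to a cleverly chosen
-- internal formula:
--   I ⇒ OS*:  instantiate I with  ψ(x,s) :≡ x ∈ s ∧ φ(s)  (a standard s is its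
--             own witness); the resulting s is hyperfinite and satisfies φ.
--   OS* ⇒ I:  instantiate OS* with  χ(s) :≡ ∃y ∀x∈s φ(x,y); a hyperfinite s
--             with χ(s) contains every standard x, so its witness y works.

open import Defs
open import Data.Product using (_×_; _,_)
open import Data.List using ([]; _∷_)
open import Data.List.Relation.Unary.Any using (here; there)
open import Relation.Binary.PropositionalEquality

variable
  Γ Γ' Δ Θ : Ctx
  σ τ : Ty

_≗ₛ_ : Sub Γ Δ → Sub Γ Δ → Set
_≗ₛ_ {Γ} θ θ' = ∀ {σ} (x : Var Γ σ) → θ x ≡ θ' x

liftS-cong : {θ θ' : Sub Γ Δ} → θ ≗ₛ θ' → liftS {τ = τ} θ ≗ₛ liftS θ'
liftS-cong e Var.here      = refl
liftS-cong e (Var.there x) = cong wkT (e x)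

subT-cong : {θ θ' : Sub Γ Δ} → θ ≗ₛ θ' → (t : Tm Γ σ) → subT θ t ≡ subT θ' t
subT-cong e (var x) = e x
subT-cong e (con c) = refl
subT-cong e (t · u) = cong₂ _·_ (subT-cong e t) (subT-cong e u)

subF-cong : {θ θ' : Sub Γ Δ} → θ ≗ₛ θ' → (φ : Fm Γ) → subF θ φ ≡ subF θ' φ
subF-cong e (s ≐ t)   = cong₂ _≐_ (subT-cong e s) (subT-cong e t)
subF-cong e (st t)    = cong st (subT-cong e t)
subF-cong e ⊥'        = refl
subF-cong e (φ ∧' ψ)  = cong₂ _∧'_ (subF-cong e φ) (subF-cong e ψ)
subF-cong e (φ ∨' ψ)  = cong₂ _∨'_ (subF-cong e φ) (subF-cong e ψ)
subF-cong e (φ ⊃ ψ)   = cong₂ _⊃_ (subF-cong e φ) (subF-cong e ψ)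
subF-cong e (All σ φ) = cong (All σ) (subF-cong (liftS-cong e) φ)
subF-cong e (Ex σ φ)  = cong (Ex σ) (subF-cong (liftS-cong e) φ)

liftS-var : liftS {Γ} {Γ} {τ} var ≗ₛ var
liftS-var Var.here      = refl
liftS-var (Var.there x) = refl

subT-id : (t : Tm Γ σ) → subT var t ≡ t
subT-id (var x) = refl
subT-id (con c) = refl
subT-id (t · u) = cong₂ _·_ (subT-id t) (subT-id u)

subF-id : (φ : Fm Γ) → subF var φ ≡ φ
subF-id (s ≐ t)   = cong₂ _≐_ (subT-id s) (subT-id t)
subF-id (st t)    = cong st (subT-id t)
subF-id ⊥'        = refl
subF-id (φ ∧' ψ)  = cong₂ _∧'_ (subF-id φ) (subF-id ψ)
subF-id (φ ∨' ψ)  = cong₂ _∨'_ (subF-id φ) (subF-id ψ)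
subF-id (φ ⊃ ψ)   = cong₂ _⊃_ (subF-id φ) (subF-id ψ)
subF-id (All σ φ) = cong (All σ) (trans (subF-cong liftS-var φ) (subF-id φ))
subF-id (Ex σ φ)  = cong (Ex σ) (trans (subF-cong liftS-var φ) (subF-id φ))

ren⇒sub : Ren Γ Δ → Sub Γ Δ
ren⇒sub ρ x = var (ρ x)

liftS-ren : (ρ : Ren Γ Δ) → liftS {τ = τ} (ren⇒sub ρ) ≗ₛ ren⇒sub (liftR ρ)
liftS-ren ρ Var.here      = refl
liftS-ren ρ (Var.there x) = refl

renT-as-subT : (ρ : Ren Γ Δ) (t : Tm Γ σ) → renT ρ t ≡ subT (ren⇒sub ρ) t
renT-as-subT ρ (var x) = refl
renT-as-subT ρ (con c) = refl
renT-as-subT ρ (t · u) = cong₂ _·_ (renT-as-subT ρ t) (renT-as-subT ρ u)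

renF-as-subF : (ρ : Ren Γ Δ) (φ : Fm Γ) → renF ρ φ ≡ subF (ren⇒sub ρ) φ
renF-as-subF ρ (s ≐ t)   = cong₂ _≐_ (renT-as-subT ρ s) (renT-as-subT ρ t)
renF-as-subF ρ (st t)    = cong st (renT-as-subT ρ t)
renF-as-subF ρ ⊥'        = refl
renF-as-subF ρ (φ ∧' ψ)  = cong₂ _∧'_ (renF-as-subF ρ φ) (renF-as-subF ρ ψ)
renF-as-subF ρ (φ ∨' ψ)  = cong₂ _∨'_ (renF-as-subF ρ φ) (renF-as-subF ρ ψ)
renF-as-subF ρ (φ ⊃ ψ)   = cong₂ _⊃_ (renF-as-subF ρ φ) (renF-as-subF ρ ψ)
renF-as-subF ρ (All σ φ) =
  cong (All σ) (trans (renF-as-subF (liftR ρ) φ) (sym (subF-cong (liftS-ren ρ) φ)))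
renF-as-subF ρ (Ex σ φ)  =
  cong (Ex σ) (trans (renF-as-subF (liftR ρ) φ) (sym (subF-cong (liftS-ren ρ) φ)))

subT-renT : (θ : Sub Δ Θ) (ρ : Ren Γ Δ) (t : Tm Γ σ) →
            subT θ (renT ρ t) ≡ subT (λ x → θ (ρ x)) t
subT-renT θ ρ (var x) = refl
subT-renT θ ρ (con c) = refl
subT-renT θ ρ (t · u) = cong₂ _·_ (subT-renT θ ρ t) (subT-renT θ ρ u)

renT-subT : (ρ : Ren Δ Θ) (θ : Sub Γ Δ) (t : Tm Γ σ) →
            renT ρ (subT θ t) ≡ subT (λ x → renT ρ (θ x)) t
renT-subT ρ θ (var x) = refl
renT-subT ρ θ (con c) = refl
renT-subT ρ θ (t · u) = cong₂ _·_ (renT-subT ρ θ t) (renT-subT ρ θ u)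

subT-wkT : (θ : Sub Γ Δ) (t : Tm Γ σ) → subT (liftS {τ = τ} θ) (wkT t) ≡ wkT (subT θ t)
subT-wkT θ t = trans (subT-renT (liftS θ) Var.there t) (sym (renT-subT Var.there θ t))

_⊙_ : Sub Δ Θ → Sub Γ Δ → Sub Γ Θ
(θ ⊙ θ') x = subT θ (θ' x)

liftS-⊙ : (θ : Sub Δ Θ) (θ' : Sub Γ Δ) → (liftS {τ = τ} θ ⊙ liftS θ') ≗ₛ liftS (θ ⊙ θ')
liftS-⊙ θ θ' Var.here      = refl
liftS-⊙ θ θ' (Var.there x) = subT-wkT θ (θ' x)

subT-⊙ : (θ : Sub Δ Θ) (θ' : Sub Γ Δ) (t : Tm Γ σ) → subT θ (subT θ' t) ≡ subT (θ ⊙ θ') t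
subT-⊙ θ θ' (var x) = refl
subT-⊙ θ θ' (con c) = refl
subT-⊙ θ θ' (t · u) = cong₂ _·_ (subT-⊙ θ θ' t) (subT-⊙ θ θ' u)

subF-⊙ : (θ : Sub Δ Θ) (θ' : Sub Γ Δ) (φ : Fm Γ) → subF θ (subF θ' φ) ≡ subF (θ ⊙ θ') φ
subF-⊙ θ θ' (s ≐ t)   = cong₂ _≐_ (subT-⊙ θ θ' s) (subT-⊙ θ θ' t)
subF-⊙ θ θ' (st t)    = cong st (subT-⊙ θ θ' t)
subF-⊙ θ θ' ⊥'        = refl
subF-⊙ θ θ' (φ ∧' ψ)  = cong₂ _∧'_ (subF-⊙ θ θ' φ) (subF-⊙ θ θ' ψ)
subF-⊙ θ θ' (φ ∨' ψ)  = cong₂ _∨'_ (subF-⊙ θ θ' φ) (subF-⊙ θ θ' ψ)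
subF-⊙ θ θ' (φ ⊃ ψ)   = cong₂ _⊃_ (subF-⊙ θ θ' φ) (subF-⊙ θ θ' ψ)
subF-⊙ θ θ' (All σ φ) =
  cong (All σ) (trans (subF-⊙ (liftS θ) (liftS θ') φ) (subF-cong (liftS-⊙ θ θ') φ))
subF-⊙ θ θ' (Ex σ φ)  =
  cong (Ex σ) (trans (subF-⊙ (liftS θ) (liftS θ') φ) (subF-cong (liftS-⊙ θ θ') φ))

subF-renF : (θ : Sub Δ Θ) (ρ : Ren Γ Δ) (φ : Fm Γ) →
            subF θ (renF ρ φ) ≡ subF (λ x → θ (ρ x)) φ
subF-renF θ ρ φ = trans (cong (subF θ) (renF-as-subF ρ φ)) (subF-⊙ θ (ren⇒sub ρ) φ)

internal-subF : (θ : Sub Γ Δ) {φ : Fm Γ} → Internal φ → Internal (subF θ φ)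
internal-subF θ i≐       = i≐
internal-subF θ i⊥       = i⊥
internal-subF θ (i∧ p q) = i∧ (internal-subF θ p) (internal-subF θ q)
internal-subF θ (i∨ p q) = i∨ (internal-subF θ p) (internal-subF θ q)
internal-subF θ (i⊃ p q) = i⊃ (internal-subF θ p) (internal-subF θ q)
internal-subF θ (iA p)   = iA (internal-subF (liftS θ) p)
internal-subF θ (iE p)   = iE (internal-subF (liftS θ) p)

internal-renF : (ρ : Ren Γ Δ) {φ : Fm Γ} → Internal φ → Internal (renF ρ φ)
internal-renF ρ {φ} p = subst Internal (sym (renF-as-subF ρ φ)) (internal-subF (ren⇒sub ρ) p)

internal-∈ : {a : Tm Γ σ} {s : Tm Γ (σ *)} → Internal (a ∈' s)
internal-∈ = iE (i∧ (iE i≐) i≐)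

-- The default element (used by the projection s_i out of range) is closed,
-- so substitution leaves the constant function  λ i. dflt σ  unchanged.
subT-lam-dflt : (θ : Sub Γ Δ) (σ : Ty) → subT (liftS {τ = ι} θ) (lam {σ = ι} (dflt σ)) ≡ lam (dflt σ)
subT-lam-dflt θ ι       = refl
subT-lam-dflt θ (σ ⇒ τ) = cong (con S · (con K · con K) ·_) (subT-lam-dflt θ τ)
subT-lam-dflt θ (σ *)   = refl

-- The membership formula  a ∈ s  as a function of its four term
-- constituents under the bound index i: the element, the sequence (in the
-- projection s_i), the sequence under the second binder of  i < |s|, and the
-- out-of-range default function.  Substitution acts on each separately.
∈-shape : Tm (ι ∷ Γ) σ → Tm (ι ∷ Γ) (σ *) → Tm (ι ∷ ι ∷ Γ) (σ *) → Tm (ι ∷ Γ) (ι ⇒ σ) → Fm Γ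
∈-shape {σ = σ} a s s' d =
  Ex ι (Ex ι (wkT v0 +' Sc v0 ≐ len s')
        ∧' (a ≐ con (L {σ} {ι ⇒ σ}) · d
                  · lam (lam (lam (con R · v1 · lam (lam (var (there (there (there (there here)))) · v0)) · v0)))
                  · s · v0))

∈-shape-cong : ∀ {a a' : Tm (ι ∷ Γ) σ} {s s' r r' d d'} →
               a ≡ a' → s ≡ s' → r ≡ r' → d ≡ d' → ∈-shape a s r d ≡ ∈-shape a' s' r' d'
∈-shape-cong refl refl refl refl = refl

subF-∈ : (θ : Sub Γ Δ) (a : Tm Γ σ) (s : Tm Γ (σ *)) →
         subF θ (a ∈' s) ≡ (subT θ a ∈' subT θ s)
subF-∈ {σ = σ} θ a s =
  ∈-shape-cong (subT-wkT θ a) (subT-wkT θ s)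
               (trans (subT-wkT (liftS θ) (wkT s)) (cong wkT (subT-wkT θ s)))
               (subT-lam-dflt θ σ)

transport : ∀ {T : Theory} {Δ'} {φ ψ : Fm Γ} → φ ≡ ψ → Der T Γ Δ' φ → Der T Γ Δ' ψ
transport refl d = d

hyp₀ : ∀ {T : Theory} {Δ'} {φ : Fm Γ} → Der T Γ (φ ∷ Δ') φ
hyp₀ = hyp (here refl)

hyp₁ : ∀ {T : Theory} {Δ'} {φ ψ : Fm Γ} → Der T Γ (ψ ∷ φ ∷ Δ') φ
hyp₁ = hyp (there (here refl))

hyp₂ : ∀ {T : Theory} {Δ'} {φ ψ χ : Fm Γ} → Der T Γ (χ ∷ ψ ∷ φ ∷ Δ') φ
hyp₂ = hyp (there (there (here refl)))

subF-renF² : (θ : Sub Δ Θ) (ρ : Ren Γ Δ) (ρ' : Ren Γ' Γ) (φ : Fm Γ') →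
             subF θ (renF ρ (renF ρ' φ)) ≡ subF (λ x → θ (ρ (ρ' x))) φ
subF-renF² θ ρ ρ' φ = trans (subF-renF θ ρ (renF ρ' φ)) (subF-renF (λ x → θ (ρ x)) ρ' φ)

subF-renF-inverse : (θ : Sub Δ Γ) (ρ : Ren Γ Δ) → (∀ {σ} (x : Var Γ σ) → θ (ρ x) ≡ var x) →
                    (φ : Fm Γ) → subF θ (renF ρ φ) ≡ φ
subF-renF-inverse θ ρ inv φ = trans (subF-renF θ ρ φ) (trans (subF-cong inv φ) (subF-id φ))

subF-renF-∈ : (θ : Sub Δ Θ) (ρ : Ren Γ Δ) (a : Tm Γ σ) (s : Tm Γ (σ *)) →
              subF θ (renF ρ (a ∈' s)) ≡ (subT (λ x → θ (ρ x)) a ∈' subT (λ x → θ (ρ x)) s)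
subF-renF-∈ θ ρ a s = trans (subF-renF θ ρ (a ∈' s)) (subF-∈ _ a s)

subF-renF²-∈ : (θ : Sub Δ Θ) (ρ : Ren Γ Δ) (ρ' : Ren Γ' Γ) (a : Tm Γ' σ) (s : Tm Γ' (σ *)) →
               subF θ (renF ρ (renF ρ' (a ∈' s))) ≡
               (subT (λ x → θ (ρ (ρ' x))) a ∈' subT (λ x → θ (ρ (ρ' x))) s)
subF-renF²-∈ θ ρ ρ' a s = trans (subF-renF² θ ρ ρ' (a ∈' s)) (subF-∈ _ a s)

-- Given  ∀^st s φ(s), apply I to
-- ψ(x,s) :≡ x ∈ s ∧ φ(s):  for standard s the witness y := s satisfies
-- ∀x∈s ψ(x,y).  I then yields s with  ∀^st x (x ∈ s ∧ φ(s)), i.e. hyper(s),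
-- and φ(s) follows by instantiating x with the standard closed term dflt σ.
I⇒OS* : (T : Theory) →
        (∀ {Γ} σ τ (φ : Fm (σ ∷ τ ∷ Γ)) → Internal φ → T (I-inst σ τ φ)) →
        (∀ {Γ σ} (a : Tm [] σ) → T {Γ} (st (closed a))) →
        (σ : Ty) (φ : Fm (σ * ∷ Γ)) → Internal φ → T ⊢ OS-inst σ φ
I⇒OS* {Γ} T I-ax st-closed-ax σ φ internal-φ =
  ⊃I (∃E (⊃E (ax (I-ax σ (σ *) ψ internal-ψ)) self-witness) hyper-and-φ)
  where
  ψ : Fm (σ ∷ σ * ∷ Γ)
  ψ = (v0 ∈' v1) ∧' wkF φ

  internal-ψ : Internal ψ
  internal-ψ = i∧ internal-∈ (internal-renF Var.there internal-φ)

  -- Premise of I: every standard s is its own witness.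
  self-witness : Der T Γ (All (σ *) (st v0 ⊃ φ) ∷ [])
                   (All (σ *) (st v0 ⊃ Ex (σ *) (All σ ((v0 ∈' v2) ⊃ renF (liftR (liftR Var.there)) ψ))))
  self-witness = ∀I (⊃I (∃I v0 (∀I (⊃I (∧I (transport x∈s hyp₀)
                                              (transport φ[s] (⊃E (∀E hyp₂ v1) hyp₁)))))))
    where
    -- The hypothesis x ∈ s is the first conjunct of ψ(x,y) at y := s.
    x∈s : subF (liftS (single v0)) (v0 ∈' v2)
          ≡ subF (liftS (single v0)) (renF (liftR (liftR Var.there)) (v0 ∈' v1))
    x∈s = trans (subF-∈ _ v0 v2) (sym (subF-renF-∈ _ _ v0 v1))

    -- φ(s), obtained from ∀^st s φ(s), is the second conjunct of ψ(x,y) at y := s.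
    φ[s] : subF (single v1) (renF (liftR Var.there) (renF (liftR Var.there) φ))
           ≡ subF (liftS (single v0)) (renF (liftR (liftR Var.there)) (wkF φ))
    φ[s] = trans (subF-renF² _ _ _ φ)
           (trans (subF-cong (λ { Var.here → refl ; (Var.there x) → refl }) φ)
                  (sym (subF-renF² _ _ _ φ)))

  hyper-and-φ : Der T (σ * ∷ Γ) (All σ (st v0 ⊃ ψ) ∷ wkF (All (σ *) (st v0 ⊃ φ)) ∷ [])
                  (wkF (Ex (σ *) (hyper σ v0 ∧' φ)))
  hyper-and-φ =
    ∃I v0 (∧I (∀I (⊃I (transport x∈s (∧E₁ (⊃E (∀E hyp₁ v0) hyp₀)))))
              (transport φ[s] (∧E₂ (⊃E (∀E hyp₀ (closed (dflt σ))) (ax (st-closed-ax (dflt σ)))))))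
    where
    -- The first conjunct of ψ(x,s) is the body of hyper(s).
    x∈s : subF (single v0) (renF (liftR Var.there) (v0 ∈' v1))
          ≡ subF (liftS (single v0)) (renF (liftR (liftR Var.there)) (v0 ∈' v1))
    x∈s = trans (subF-renF-∈ _ _ v0 v1) (sym (subF-renF-∈ _ _ v0 v1))

    -- Both sides are φ itself.
    φ[s] : subF (single (closed (dflt σ))) (wkF φ) ≡ subF (single v0) (renF (liftR Var.there) φ)
    φ[s] = trans (subF-renF-inverse _ Var.there (λ x → refl) φ)
                 (sym (subF-renF-inverse _ (liftR Var.there)
                                         (λ { Var.here → refl ; (Var.there x) → refl }) φ))

-- Given  ∀^st s ∃y ∀x∈s φ(x,y),  apply OS* to the internal
-- formula  χ(s) :≡ ∃y ∀x∈s φ(x,y):  it yields a hyperfinite s with χ(s), and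
-- the witness y for s works for every standard x, since such x lie in s.
OS*⇒I : (T : Theory) →
        (∀ {Γ} σ (φ : Fm (σ * ∷ Γ)) → Internal φ → T (OS-inst σ φ)) →
        (σ τ : Ty) (φ : Fm (σ ∷ τ ∷ Γ)) → Internal φ → T ⊢ I-inst σ τ φ
OS*⇒I {Γ} T OS-ax σ τ φ internal-φ =
  ⊃I (∃E (⊃E (ax (OS-ax σ χ internal-χ)) hyp₀) (∃E (∧E₂ hyp₀) witness-works))
  where
  φ↑ : Fm (σ ∷ τ ∷ σ * ∷ Γ)
  φ↑ = renF (liftR (liftR Var.there)) φ

  χ : Fm (σ * ∷ Γ)
  χ = Ex τ (All σ ((v0 ∈' v2) ⊃ φ↑))

  internal-χ : Internal χ
  internal-χ = iE (iA (i⊃ internal-∈ (internal-renF _ internal-φ)))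

  witness-works : Der T (τ ∷ σ * ∷ Γ)
                    (All σ ((v0 ∈' v2) ⊃ φ↑) ∷ wkF (hyper σ v0 ∧' χ)
                      ∷ wkF (wkF (All (σ *) (st v0 ⊃ χ))) ∷ [])
                    (wkF (wkF (Ex τ (All σ (st v0 ⊃ φ)))))
  witness-works = ∃I v0 (∀I (⊃I (transport φ[x,y] (⊃E (∀E hyp₁ v0)
                                                      (transport x∈s (⊃E (∀E (∧E₁ hyp₂) v0) hyp₀))))))
    where
    -- hyper(s) at the standard x gives exactly the antecedent x ∈ s of χ's body.
    x∈s : subF (single v0) (renF (liftR Var.there) (renF (liftR Var.there) (v0 ∈' v1)))
          ≡ subF (single v0) (renF (liftR Var.there) (v0 ∈' v2))
    x∈s = trans (subF-renF²-∈ _ _ _ v0 v1) (sym (subF-renF-∈ _ _ v0 v2))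

    -- The consequent of χ's body is the required φ(x,y).
    φ[x,y] : subF (single v0) (renF (liftR Var.there) φ↑)
             ≡ subF (liftS (single v0))
                    (renF (liftR (liftR Var.there)) (renF (liftR (liftR Var.there)) φ))
    φ[x,y] = trans (subF-renF² _ _ _ φ)
             (trans (subF-cong (λ { Var.here → refl ; (Var.there Var.here) → refl
                                  ; (Var.there (Var.there x)) → refl }) φ)
                    (sym (subF-renF² _ _ _ φ)))

mainTheorem1 : ((Γ : Ctx) (σ : Ty) (φ : Fm (σ * ∷ Γ)) → Internal φ →
                 (Base +Ax ISchema) ⊢ OS-inst σ φ)
               × ((Γ : Ctx) (σ τ : Ty) (φ : Fm (σ ∷ τ ∷ Γ)) → Internal φ →
                 (Base +Ax OSSchema) ⊢ I-inst σ τ φ)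
mainTheorem1 =
  (λ Γ → I⇒OS* (Base +Ax ISchema) (λ σ τ φ i → extra (inst σ τ φ i)) (λ a → base (st-closed a)))
  , (λ Γ → OS*⇒I (Base +Ax OSSchema) (λ σ φ i → extra (inst σ φ i)))
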